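{- For the $n$-dimensional hypercube $Q_n$ and any vertex $v$ of $Q_n$, $f_p(Q_n,v)=1$ if $n=0$, $f_p(Q_n,v)=2$ if $n=1$, and $f_p(Q_n,v)=4$ if $n\ge 2$.
   Context: $Q_n$ is the graph whose vertices are the binary strings of length $n$, two strings being adjacent iff they differ in exactly one position. The \emph{path variant of the Explorer–Director game} on a finite connected graph $G$ with starting vertex $v$: a single token starts on $v$. In each round, if the token is on vertex $u$, the Explorer names a positive integer $l$ such that $G$ contains a path (no repeated vertices) of length $l$ starting at $u$, and the Director moves the token to any vertex $w$ such that $G$ contains a $uw$ path of length $l$. A vertex is visited if the token has ever been on it (the starting vertex counts). The Explorer aims to maximize and the Director to minimize the number of visited vertices; the game ends when the Director can keep the token on already visited vertices indefinitely. $f_p(G,v)$ denotes the number of visited vertices at the end under optimal play. -}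

module Defs where

open import Data.Nat using (ℕ; zero; suc; _+_; _≤_)
open import Data.Bool using (Bool; if_then_else_; _xor_)
open import Data.Vec using (Vec; []; _∷_)
open import Data.Fin using (Fin; fromℕ; inject₁)
open import Data.List using (List; []; _∷_; length)
open import Data.List.Membership.Propositional using (_∈_)
open import Data.List.Relation.Unary.All using (All)
open import Data.List.Relation.Unary.Unique.Propositional using (Unique)
open import Data.Product using (Σ; ∃; _×_; _,_)
open import Function.Definitions using (Injective)
open import Relation.Binary.PropositionalEquality using (_≡_)
open import Relation.Nullary using (¬_)

HasPath : {V : Set} → (V → V → Set) → V → V → ℕ → Set
HasPath {V} Adj u w l =
  Σ (Fin (suc l) → V) λ p →
    (p Fin.zero ≡ u) × (p (fromℕ l) ≡ w) × Injective _≡_ _≡_ p ×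
    ((i : Fin l) → Adj (p (inject₁ i)) (p (Fin.suc i)))

AtLeast : {V : Set} → ℕ → List V → Set
AtLeast {V} k S = Σ (List V) λ xs → Unique xs × length xs ≡ k × All (_∈ S) xs

-- ExplorerForces Adj k S u : with the token on u and visited list S,
-- the Explorer has a strategy forcing at least k distinct visited vertices
-- no matter how the Director plays.
data ExplorerForces {V : Set} (Adj : V → V → Set) (k : ℕ) : List V → V → Set where
  done : ∀ {S u} → AtLeast k S → ExplorerForces Adj k S u
  move : ∀ {S u} (l : ℕ) → 1 ≤ l → (∃ λ w → HasPath Adj u w l) →
         (∀ w → HasPath Adj u w l → ExplorerForces Adj k (w ∷ S) w) →
         ExplorerForces Adj k S u

-- f_p(G, v) = c : the Explorer can force c visited vertices but not c+1
-- (the value of the game under optimal play).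
FpValue : {V : Set} → (V → V → Set) → V → ℕ → Set
FpValue Adj v c = ExplorerForces Adj c (v ∷ []) v × ¬ ExplorerForces Adj (suc c) (v ∷ []) v

hamming : ∀ {n} → Vec Bool n → Vec Bool n → ℕ
hamming [] [] = 0
hamming (a ∷ x) (b ∷ y) = (if a xor b then 1 else 0) + hamming x y

QAdj : (n : ℕ) → Vec Bool n → Vec Bool n → Set
QAdj n x y = hamming x y ≡ 1

-- Director: a path in Q_(m+2) has length l < 2^(m+2), and for every such l ≥ 1 there is a path of
-- length l from x y t to a vertex x′ y′ t of the same square, snaking along a Gray code of Q_m
-- through the four copies of Q_m indexed by the first two coordinates. Answering every move in this
-- way confines the token to the four vertices of the starting square; for n ≤ 1 the whole cube has
-- at most two vertices.
-- Explorer: in Q_(m+2) the lengths 2, 1, 2 reach a new vertex of the starting parity and then two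
-- distinct vertices of the other parity, so four vertices are visited.

module Submission where

open import Defs
open import Data.Nat using (ℕ; zero; suc; _+_; _*_; _^_; _≤_; _<_; z≤n; s≤s)
open import Data.Nat.Properties
  using (1+n≰n; +-suc; +-identityʳ; suc-injective; m≤n⇒m<n∨m≡n; <⇒≤; ≤-trans; m^n>0; *-monoʳ-≤)
open import Data.Nat.Solver using (module +-*-Solver)
open import Data.Bool using (Bool; true; false; not; _xor_)
open import Data.Bool.Properties using (not-¬; not-involutive)
open import Data.Vec using (Vec; []; _∷_; head; tail)
open import Data.Vec.Properties using (∷-injectiveˡ; ∷-injectiveʳ)
open import Data.Fin as Fin using (Fin; fromℕ; inject₁)
open import Data.Fin.Properties using (injective⇒≤)
open import Data.List as List using (List; []; _∷_; length; _++_)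
open import Data.List.Properties using (length-++; length-map; unfold-reverse)
open import Data.List.Membership.Propositional using (_∈_; _∉_)
open import Data.List.Membership.Propositional.Properties
  using (∈-lookup; ∈-map⁺; ∈-map⁻; ∈-++⁻; ∈-++⁺ˡ; ∈-++⁺ʳ)
open import Data.List.Membership.Setoid.Properties using (index-injective)
open import Data.List.Relation.Unary.Any using (here; there)
open import Data.List.Relation.Unary.All as All using (All; []; _∷_)
import Data.List.Relation.Unary.All.Properties as All
open import Data.List.Relation.Unary.Unique.Propositional using (Unique; []; _∷_)
import Data.List.Relation.Unary.Unique.Propositional.Properties as Unique
open import Data.List.Relation.Binary.Disjoint.Propositional using (Disjoint)
open import Data.List.Relation.Binary.Permutation.Propositional using (↭⇒↭ₛ; ↭-sym)
open import Data.List.Relation.Binary.Permutation.Propositional.Properties using (↭-reverse)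
open import Data.List.Relation.Binary.Permutation.Setoid.Properties using (Unique-resp-↭)
open import Data.Product using (Σ; ∃; ∃₂; _×_; _,_; -,_; proj₂; map₂)
open import Data.Sum using (inj₁; inj₂)
open import Data.Unit using (⊤; tt)
open import Data.Empty using (⊥-elim)
open import Function using (_∘_)
open import Function.Definitions using (Injective)
open import Relation.Binary.Definitions using (Symmetric)
open import Relation.Binary.PropositionalEquality

open +-*-Solver

private variable
  A V W : Set
  Adj Adj′ : V → V → Set
  a b c d : V
  k l l₁ l₂ n : ℕ
  xs ys : List A

Unique⇒lookup-injective : Unique xs → Injective _≡_ _≡_ (List.lookup xs)
Unique⇒lookup-injective (_ ∷ _) {Fin.zero} {Fin.zero} _ = refl
Unique⇒lookup-injective (x∉xs ∷ _) {Fin.zero} {Fin.suc j} eq =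
  ⊥-elim (All.lookup x∉xs (∈-lookup j) eq)
Unique⇒lookup-injective (x∉xs ∷ _) {Fin.suc i} {Fin.zero} eq =
  ⊥-elim (All.lookup x∉xs (∈-lookup i) (sym eq))
Unique⇒lookup-injective (_ ∷ u) {Fin.suc i} {Fin.suc j} eq =
  cong Fin.suc (Unique⇒lookup-injective u eq)

injective⇒≤length : {f : Fin k → A} → Injective _≡_ _≡_ f → (∀ i → f i ∈ ys) →
  k ≤ length ys
injective⇒≤length f-inj f∈ys =
  injective⇒≤ (λ {i} {j} eq → f-inj (index-injective (setoid _) (f∈ys i) (f∈ys j) eq))

Unique⇒length≤ : Unique xs → All (_∈ ys) xs → length xs ≤ length ys
Unique⇒length≤ u xs⊆ys =
  injective⇒≤length (Unique⇒lookup-injective u) (All.lookup xs⊆ys ∘ ∈-lookup)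

disjoint-by-label : ∀ {L : Set} (f : A → L) {ℓ ℓ′} → ℓ ≢ ℓ′ →
  All (λ x → f x ≡ ℓ) xs → All (λ y → f y ≡ ℓ′) ys → Disjoint xs ys
disjoint-by-label f ℓ≢ℓ′ fxs fys (x∈xs , x∈ys) =
  ℓ≢ℓ′ (trans (sym (All.lookup fxs x∈xs)) (All.lookup fys x∈ys))

-- Walks

data Walk {V : Set} (Adj : V → V → Set) : V → V → ℕ → Set where
  [_]    : ∀ a → Walk Adj a a 0
  _∷⟨_⟩_ : ∀ a {b c l} → Adj a b → Walk Adj b c l → Walk Adj a c (suc l)

vertices : Walk {V} Adj a b l → List V
vertices [ a ] = a ∷ []
vertices (a ∷⟨ _ ⟩ w) = a ∷ vertices w

IsPath : Walk Adj a b l → Set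
IsPath w = Unique (vertices w)

_++⟨_⟩_ : Walk Adj a b l₁ → Adj b c → Walk Adj c d l₂ → Walk Adj a d (l₁ + suc l₂)
[ a ] ++⟨ e ⟩ w′ = a ∷⟨ e ⟩ w′
(a ∷⟨ e ⟩ w) ++⟨ f ⟩ w′ = a ∷⟨ e ⟩ (w ++⟨ f ⟩ w′)

snoc : Walk Adj a b l → Adj b c → Walk Adj a c (suc l)
snoc [ a ] e = a ∷⟨ e ⟩ [ _ ]
snoc (a ∷⟨ e ⟩ w) f = a ∷⟨ e ⟩ snoc w f

reverse : Symmetric Adj → Walk Adj a b l → Walk Adj b a l
reverse sym-adj [ a ] = [ a ]
reverse sym-adj (a ∷⟨ e ⟩ w) = snoc (reverse sym-adj w) (sym-adj e)

take : ∀ k → k ≤ l → Walk Adj a b l → ∃ λ c → Walk Adj a c k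
take zero _ [ a ] = a , [ a ]
take zero _ (a ∷⟨ _ ⟩ _) = a , [ a ]
take (suc k) (s≤s k≤l) (a ∷⟨ e ⟩ w) = map₂ (a ∷⟨ e ⟩_) (take k k≤l w)

map : (f : V → W) → (∀ {u v} → Adj u v → Adj′ (f u) (f v)) →
  Walk Adj a b l → Walk Adj′ (f a) (f b) l
map f f-adj [ a ] = [ f a ]
map f f-adj (a ∷⟨ e ⟩ w) = f a ∷⟨ f-adj e ⟩ map f f-adj w

vertices-++ : (w : Walk Adj a b l₁) (e : Adj b c) (w′ : Walk Adj c d l₂) →
  vertices (w ++⟨ e ⟩ w′) ≡ vertices w ++ vertices w′
vertices-++ [ a ] e w′ = refl
vertices-++ (a ∷⟨ _ ⟩ w) e w′ = cong (a ∷_) (vertices-++ w e w′)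

vertices-snoc : (w : Walk Adj a b l) (e : Adj b c) → vertices (snoc w e) ≡ vertices w List.∷ʳ c
vertices-snoc [ a ] e = refl
vertices-snoc (a ∷⟨ _ ⟩ w) e = cong (a ∷_) (vertices-snoc w e)

vertices-reverse : (sym-adj : Symmetric Adj) (w : Walk Adj a b l) →
  vertices (reverse sym-adj w) ≡ List.reverse (vertices w)
vertices-reverse sym-adj [ a ] = refl
vertices-reverse sym-adj (a ∷⟨ e ⟩ w) = begin
  vertices (snoc (reverse sym-adj w) (sym-adj e))  ≡⟨ vertices-snoc (reverse sym-adj w) (sym-adj e) ⟩
  vertices (reverse sym-adj w) List.∷ʳ a           ≡⟨ cong (List._∷ʳ a) (vertices-reverse sym-adj w) ⟩
  List.reverse (vertices w) List.∷ʳ a              ≡⟨ unfold-reverse a (vertices w) ⟨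
  List.reverse (a ∷ vertices w)                    ∎
  where open ≡-Reasoning

vertices-take : ∀ k (k≤l : k ≤ l) (w : Walk Adj a b l) →
  vertices (proj₂ (take k k≤l w)) ≡ List.take (suc k) (vertices w)
vertices-take zero _ [ a ] = refl
vertices-take zero _ (a ∷⟨ _ ⟩ _) = refl
vertices-take (suc k) (s≤s k≤l) (a ∷⟨ _ ⟩ w) = cong (a ∷_) (vertices-take k k≤l w)

vertices-map : (f : V → W) (f-adj : ∀ {u v} → Adj u v → Adj′ (f u) (f v)) (w : Walk Adj a b l) →
  vertices (map {Adj′ = Adj′} f f-adj w) ≡ List.map f (vertices w)
vertices-map f f-adj [ a ] = refl
vertices-map f f-adj (a ∷⟨ _ ⟩ w) = cong (f a ∷_) (vertices-map f f-adj w)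

++-isPath : {w : Walk Adj a b l₁} {e : Adj b c} {w′ : Walk Adj c d l₂} →
  IsPath w → IsPath w′ → Disjoint (vertices w) (vertices w′) → IsPath (w ++⟨ e ⟩ w′)
++-isPath {w = w} {e} {w′} p p′ disj =
  subst Unique (sym (vertices-++ w e w′)) (Unique.++⁺ p p′ disj)

reverse-isPath : (sym-adj : Symmetric Adj) {w : Walk Adj a b l} →
  IsPath w → IsPath (reverse sym-adj w)
reverse-isPath sym-adj {w} p = subst Unique (sym (vertices-reverse sym-adj w))
  (Unique-resp-↭ (setoid _) (↭⇒↭ₛ (↭-sym (↭-reverse (vertices w)))) p)

take-isPath : ∀ k (k≤l : k ≤ l) {w : Walk Adj a b l} →
  IsPath w → IsPath (proj₂ (take k k≤l w))
take-isPath k k≤l {w} p = subst Unique (sym (vertices-take k k≤l w)) (Unique.take⁺ (suc k) p)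

map-isPath : {f : V → W} (f-adj : ∀ {u v} → Adj u v → Adj′ (f u) (f v)) → Injective _≡_ _≡_ f →
  {w : Walk Adj a b l} → IsPath w → IsPath (map {Adj′ = Adj′} f f-adj w)
map-isPath {f = f} f-adj f-inj {w} p =
  subst Unique (sym (vertices-map f f-adj w)) (Unique.map⁺ f-inj p)

vertexAt : Walk {V} Adj a b l → Fin (suc l) → V
vertexAt [ a ] _ = a
vertexAt (a ∷⟨ _ ⟩ w) Fin.zero = a
vertexAt (a ∷⟨ _ ⟩ w) (Fin.suc i) = vertexAt w i

vertexAt-first : (w : Walk Adj a b l) → vertexAt w Fin.zero ≡ a
vertexAt-first [ a ] = refl
vertexAt-first (a ∷⟨ _ ⟩ w) = refl

vertexAt-last : (w : Walk Adj a b l) → vertexAt w (fromℕ l) ≡ b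
vertexAt-last [ a ] = refl
vertexAt-last (a ∷⟨ _ ⟩ w) = vertexAt-last w

vertexAt-adjacent : (w : Walk Adj a b l) (i : Fin l) →
  Adj (vertexAt w (inject₁ i)) (vertexAt w (Fin.suc i))
vertexAt-adjacent {Adj = Adj} (a ∷⟨ e ⟩ w) Fin.zero = subst (Adj a) (sym (vertexAt-first w)) e
vertexAt-adjacent (a ∷⟨ _ ⟩ w) (Fin.suc i) = vertexAt-adjacent w i

vertexAt-∈ : (w : Walk Adj a b l) (i : Fin (suc l)) → vertexAt w i ∈ vertices w
vertexAt-∈ [ a ] Fin.zero = here refl
vertexAt-∈ (a ∷⟨ _ ⟩ w) Fin.zero = here refl
vertexAt-∈ (a ∷⟨ _ ⟩ w) (Fin.suc i) = there (vertexAt-∈ w i)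

vertexAt-injective : (w : Walk Adj a b l) → IsPath w → Injective _≡_ _≡_ (vertexAt w)
vertexAt-injective [ a ] _ {Fin.zero} {Fin.zero} _ = refl
vertexAt-injective (a ∷⟨ _ ⟩ w) _ {Fin.zero} {Fin.zero} _ = refl
vertexAt-injective (a ∷⟨ _ ⟩ w) (a∉w ∷ _) {Fin.zero} {Fin.suc j} eq =
  ⊥-elim (All.lookup a∉w (vertexAt-∈ w j) eq)
vertexAt-injective (a ∷⟨ _ ⟩ w) (a∉w ∷ _) {Fin.suc i} {Fin.zero} eq =
  ⊥-elim (All.lookup a∉w (vertexAt-∈ w i) (sym eq))
vertexAt-injective (a ∷⟨ _ ⟩ w) (_ ∷ p) {Fin.suc i} {Fin.suc j} eq =
  cong Fin.suc (vertexAt-injective w p eq)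

toHasPath : (∀ {u v} → Adj u v → Adj′ u v) → (w : Walk Adj a b l) → IsPath w →
  HasPath Adj′ a b l
toHasPath Adj⇒Adj′ w p =
  vertexAt w , vertexAt-first w , vertexAt-last w , vertexAt-injective w p ,
  Adj⇒Adj′ ∘ vertexAt-adjacent w

labels-map : ∀ {L : Set} {ℓ : L} (g : W → L) {f : V → W}
  (f-adj : ∀ {u v} → Adj u v → Adj′ (f u) (f v)) → (∀ u → g (f u) ≡ ℓ) →
  (w : Walk Adj a b l) → All (λ v → g v ≡ ℓ) (vertices (map {Adj′ = Adj′} f f-adj w))
labels-map g f-adj gf≡ℓ [ a ] = gf≡ℓ a ∷ []
labels-map g f-adj gf≡ℓ (a ∷⟨ _ ⟩ w) = gf≡ℓ a ∷ labels-map g f-adj gf≡ℓ w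

-- The hypercube

hamming-self : (v : Vec Bool n) → hamming v v ≡ 0
hamming-self [] = refl
hamming-self (true ∷ v) = hamming-self v
hamming-self (false ∷ v) = hamming-self v

hamming≡0⇒≡ : (u v : Vec Bool n) → hamming u v ≡ 0 → u ≡ v
hamming≡0⇒≡ [] [] _ = refl
hamming≡0⇒≡ (true ∷ u) (true ∷ v) eq = cong (true ∷_) (hamming≡0⇒≡ u v eq)
hamming≡0⇒≡ (false ∷ u) (false ∷ v) eq = cong (false ∷_) (hamming≡0⇒≡ u v eq)

-- Hypercube edges as an inductive relation: unlike QAdj it determines its endpoints, so Agda can
-- infer them when walks are built.
data Flip : Vec Bool n → Vec Bool n → Set where
  flip-head : ∀ {x y v} → x ≢ y → Flip {suc n} (x ∷ v) (y ∷ v)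
  flip-tail : ∀ {x u v} → Flip {n} u v → Flip (x ∷ u) (x ∷ v)

Flip-sym : Symmetric (Flip {n})
Flip-sym (flip-head x≢y) = flip-head (x≢y ∘ sym)
Flip-sym (flip-tail e) = flip-tail (Flip-sym e)

Flip⇒QAdj : {u v : Vec Bool n} → Flip u v → QAdj n u v
Flip⇒QAdj (flip-head {x = true}  {false} {v} _) = cong suc (hamming-self v)
Flip⇒QAdj (flip-head {x = false} {true}  {v} _) = cong suc (hamming-self v)
Flip⇒QAdj (flip-head {x = true}  {true}  x≢y) = ⊥-elim (x≢y refl)
Flip⇒QAdj (flip-head {x = false} {false} x≢y) = ⊥-elim (x≢y refl)
Flip⇒QAdj (flip-tail {x = true}  e) = Flip⇒QAdj e
Flip⇒QAdj (flip-tail {x = false} e) = Flip⇒QAdj e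

x≢not-x : ∀ x → x ≢ not x
x≢not-x x = not-¬ refl

allVertices : ∀ n → List (Vec Bool n)
allVertices zero = [] ∷ []
allVertices (suc n) = List.map (true ∷_) (allVertices n) ++ List.map (false ∷_) (allVertices n)

∈-allVertices : (v : Vec Bool n) → v ∈ allVertices n
∈-allVertices [] = here refl
∈-allVertices (true ∷ v) = ∈-++⁺ˡ (∈-map⁺ (true ∷_) (∈-allVertices v))
∈-allVertices {suc n} (false ∷ v) =
  ∈-++⁺ʳ (List.map (true ∷_) (allVertices n)) (∈-map⁺ (false ∷_) (∈-allVertices v))

length-allVertices : ∀ n → length (allVertices n) ≡ 2 ^ n
length-allVertices zero = refl
length-allVertices (suc n) = begin
  length (List.map (true ∷_) (allVertices n) ++ List.map (false ∷_) (allVertices n))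
    ≡⟨ length-++ (List.map (true ∷_) (allVertices n)) ⟩
  length (List.map (true ∷_) (allVertices n)) + length (List.map (false ∷_) (allVertices n))
    ≡⟨ cong₂ _+_ (length-map (true ∷_) (allVertices n)) (length-map (false ∷_) (allVertices n)) ⟩
  length (allVertices n) + length (allVertices n)
    ≡⟨ cong₂ _+_ (length-allVertices n) (trans (length-allVertices n) (sym (+-identityʳ _))) ⟩
  2 ^ suc n ∎
  where open ≡-Reasoning

path-length<2^n : HasPath (QAdj n) a b l → l < 2 ^ n
path-length<2^n {n = n} (_ , _ , _ , injective , _) =
  subst (_ ≤_) (length-allVertices n) (injective⇒≤length injective (λ i → ∈-allVertices _))

record HamiltonianPath (m : ℕ) (t : Vec Bool m) : Set where
  constructor hamiltonianPath
  field
    {end}      : Vec Bool m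
    {steps}    : ℕ
    walk       : Walk Flip t end steps
    isPath     : IsPath walk
    visits-all : suc steps ≡ 2 ^ m

consWalk : ∀ x → Walk (Flip {n}) a b l → Walk Flip (x ∷ a) (x ∷ b) l
consWalk x = map (x ∷_) flip-tail

consWalk-isPath : ∀ x {w : Walk (Flip {n}) a b l} → IsPath w → IsPath (consWalk x w)
consWalk-isPath x = map-isPath flip-tail ∷-injectiveʳ

consWalk-heads : ∀ x (w : Walk (Flip {n}) a b l) →
  All (λ v → head v ≡ x) (vertices (consWalk x w))
consWalk-heads x = labels-map head flip-tail (λ _ → refl)

grayPath : ∀ m (t : Vec Bool m) → HamiltonianPath m t
grayPath zero [] = hamiltonianPath [ [] ] ([] ∷ []) refl
grayPath (suc m) (x ∷ t) with grayPath m t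
... | hamiltonianPath G G-path visits-all = hamiltonianPath
  (consWalk x G ++⟨ flip-head (x≢not-x x) ⟩ consWalk (not x) (reverse Flip-sym G))
  (++-isPath (consWalk-isPath x G-path) (consWalk-isPath (not x) (reverse-isPath Flip-sym G-path))
     (disjoint-by-label head (x≢not-x x)
        (consWalk-heads x G) (consWalk-heads (not x) (reverse Flip-sym G))))
  (cong₂ _+_ visits-all (trans visits-all (sym (+-identityʳ (2 ^ m)))))

parity : Vec Bool n → Bool
parity [] = false
parity (x ∷ v) = x xor parity v

adjacent⇒parity-flips : (u v : Vec Bool n) → QAdj n u v → parity v ≡ not (parity u)
adjacent⇒parity-flips [] [] ()
adjacent⇒parity-flips (true ∷ u) (true ∷ v) uv = cong not (adjacent⇒parity-flips u v uv)
adjacent⇒parity-flips (false ∷ u) (false ∷ v) uv = adjacent⇒parity-flips u v uv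
adjacent⇒parity-flips (true ∷ u) (false ∷ v) uv rewrite hamming≡0⇒≡ u v (suc-injective uv) =
  sym (not-involutive (parity v))
adjacent⇒parity-flips (false ∷ u) (true ∷ v) uv rewrite hamming≡0⇒≡ u v (suc-injective uv) = refl

path-moves : {a b : Vec Bool n} → HasPath (QAdj n) a b (suc l) → b ≢ a
path-moves (_ , refl , refl , injective , _) eq with injective eq
... | ()

parity-step : HasPath (QAdj n) a b 1 → parity b ≡ not (parity a)
parity-step (p , refl , refl , _ , adjacent) =
  adjacent⇒parity-flips (p Fin.zero) (p (Fin.suc Fin.zero)) (adjacent Fin.zero)

parity-two-steps : HasPath (QAdj n) a b 2 → parity b ≡ parity a
parity-two-steps (p , refl , refl , _ , adjacent) = begin
  parity p₂              ≡⟨ adjacent⇒parity-flips p₁ p₂ (adjacent (Fin.suc Fin.zero)) ⟩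
  not (parity p₁)        ≡⟨ cong not (adjacent⇒parity-flips p₀ p₁ (adjacent Fin.zero)) ⟩
  not (not (parity p₀))  ≡⟨ not-involutive _ ⟩
  parity p₀              ∎
  where
  open ≡-Reasoning
  p₀ = p Fin.zero
  p₁ = p (Fin.suc Fin.zero)
  p₂ = p (Fin.suc (Fin.suc Fin.zero))

parity-distinguishes : {u v : Vec Bool n} → parity u ≡ not (parity v) → u ≢ v
parity-distinguishes {v = v} pu refl = x≢not-x (parity v) pu

-- Paths from a vertex back into its square

++-All : ∀ {P : V → Set} (w₁ : Walk Adj a b l₁) (e : Adj b c) (w₂ : Walk Adj c d l₂) →
  All P (vertices w₁) → All P (vertices w₂) → All P (vertices (w₁ ++⟨ e ⟩ w₂))
++-All {P = P} w₁ e w₂ p₁ p₂ = subst (All P) (sym (vertices-++ w₁ e w₂)) (All.++⁺ p₁ p₂)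

row : ∀ x y → Walk (Flip {n}) c d l → Walk Flip (x ∷ y ∷ c) (x ∷ y ∷ d) l
row x y = map (λ s → x ∷ y ∷ s) (flip-tail ∘ flip-tail)

row-isPath : ∀ x y {w : Walk (Flip {n}) c d l} → IsPath w → IsPath (row x y w)
row-isPath x y = map-isPath (flip-tail ∘ flip-tail) (∷-injectiveʳ ∘ ∷-injectiveʳ)

row-heads : ∀ x y (w : Walk (Flip {n}) c d l) →
  All (λ v → head v ≡ x) (vertices (row x y w))
row-heads x y = labels-map head (flip-tail ∘ flip-tail) (λ _ → refl)

row-seconds : ∀ x y (w : Walk (Flip {n}) c d l) →
  All (λ v → head (tail v) ≡ y) (vertices (row x y w))
row-seconds x y = labels-map (head ∘ tail) (flip-tail ∘ flip-tail) (λ _ → refl)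

∉-row : ∀ x y {s} (w : Walk (Flip {n}) c d l) → s ∉ vertices w →
  (x ∷ y ∷ s) ∉ vertices (row x y w)
∉-row x y w s∉w p with ∈-map⁻ _ (subst (_ ∈_) (vertices-map _ (flip-tail ∘ flip-tail) w) p)
... | _ , s′∈w , refl = s∉w s′∈w

zigzag : ∀ x y {s c d k k′} → Walk (Flip {n}) s c k → Walk Flip c d k′ →
  Walk Flip (x ∷ y ∷ s) (x ∷ not y ∷ d) (k + suc k′)
zigzag x y P Q = row x y P ++⟨ flip-tail (flip-head (x≢not-x y)) ⟩ row x (not y) Q

zigzag-heads : ∀ x y {s c d k k′} (P : Walk (Flip {n}) s c k) (Q : Walk Flip c d k′) →
  All (λ v → head v ≡ x) (vertices (zigzag x y P Q))
zigzag-heads x y P Q = ++-All (row x y P) _ (row x (not y) Q) (row-heads x y P) (row-heads x (not y) Q)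

zigzag-isPath : ∀ x y {s c d k k′} {P : Walk (Flip {n}) s c k} {Q : Walk Flip c d k′} →
  IsPath P → IsPath Q → IsPath (zigzag x y P Q)
zigzag-isPath x y {P = P} {Q} P-path Q-path =
  ++-isPath (row-isPath x y P-path) (row-isPath x (not y) Q-path)
  (disjoint-by-label (head ∘ tail) (x≢not-x y) (row-seconds x y P) (row-seconds x (not y) Q))

zigzag-∌ : ∀ x y {s c d k k′} (P : Walk (Flip {n}) s c k) (Q : Walk Flip c d k′) {u} →
  u ∉ vertices P → (x ∷ y ∷ u) ∉ vertices (zigzag x y P Q)
zigzag-∌ x y P Q u∉P p
  with ∈-++⁻ (vertices (row x y P)) (subst (_ ∈_) (vertices-++ (row x y P) _ (row x (not y) Q)) p)
... | inj₁ p∈P = ∉-row x y P u∉P p∈P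
... | inj₂ p∈Q = x≢not-x y (All.lookup (row-seconds x (not y) Q) p∈Q)

-- Let L + 1 = 2^m. In Q_(m+2) the vertices x y s with fixed x y form a row, a copy of Q_m; around
-- a b t lie the rows A = a b, D = a ¬b, C = ¬a ¬b and B = ¬a b. With a Gray path G : t ⇝ z of Q_m and a
-- prefix P of G, the following routes from A t end in the square of t; their lengths are the four
-- forms below and together cover 1 ≤ l < 4(L + 1):
--   odd-short   A along P, then D back along P;
--   even-short  the same, then a step to C t;
--   odd-long    A along G, D back along G, then C along P and B back along P;
--   even-long   see evenLong.
data SquareLength (L : ℕ) : ℕ → Set where
  odd-short  : ∀ {k} → k ≤ L → SquareLength L (1 + (k + k))
  even-short : ∀ {k} → k ≤ L → SquareLength L (2 + (k + k))
  odd-long   : ∀ {j} → j ≤ L → SquareLength L (3 + (L + L) + (j + j))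
  even-long  : ∀ {j} → j < L → SquareLength L (4 + (L + L) + (j + j))

squareLength-suc : ∀ {L l} → SquareLength L l → suc l < 2 * (2 * suc L) → SquareLength L (suc l)
squareLength-suc (odd-short k≤L) _ = even-short k≤L
squareLength-suc {L} (even-short {k} k≤L) _ with m≤n⇒m<n∨m≡n k≤L
... | inj₁ k<L = subst (SquareLength L) (cong (2 +_) (+-suc k k)) (odd-short k<L)
... | inj₂ refl = subst (SquareLength L) (cong (3 +_) (+-identityʳ (L + L))) (odd-long z≤n)
squareLength-suc {L} (odd-long {j} j≤L) bound with m≤n⇒m<n∨m≡n j≤L
... | inj₁ j<L = even-long j<L
... | inj₂ refl = ⊥-elim (1+n≰n (subst (5 + (L + L) + (L + L) ≤_) 4L+4 bound))
  where
  4L+4 : 2 * (2 * suc L) ≡ 4 + (L + L) + (L + L)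
  4L+4 = solve 1 (λ L → con 2 :* (con 2 :* (con 1 :+ L)) := con 4 :+ (L :+ L) :+ (L :+ L)) refl L
squareLength-suc {L} (even-long {j} j<L) _ = subst (SquareLength L) eq (odd-long j<L)
  where
  eq : 3 + (L + L) + (suc j + suc j) ≡ 5 + (L + L) + (j + j)
  eq = solve 2 (λ L j → con 3 :+ (L :+ L) :+ ((con 1 :+ j) :+ (con 1 :+ j))
                     := con 5 :+ (L :+ L) :+ (j :+ j)) refl L j

squareLength : ∀ L l → 1 ≤ l → l < 2 * (2 * suc L) → SquareLength L l
squareLength L (suc zero) _ _ = odd-short z≤n
squareLength L (suc (suc l)) _ bound =
  squareLength-suc (squareLength L (suc l) (s≤s z≤n) (<⇒≤ bound)) bound

shuttle : ∀ x y {s c k} → Walk (Flip {n}) s c k →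
  Walk Flip (x ∷ y ∷ s) (x ∷ not y ∷ s) (k + suc k)
shuttle x y P = zigzag x y P (reverse Flip-sym P)

shuttle-isPath : ∀ x y {s c k} {P : Walk (Flip {n}) s c k} → IsPath P → IsPath (shuttle x y P)
shuttle-isPath x y P-path = zigzag-isPath x y P-path (reverse-isPath Flip-sym P-path)

module _ {m : ℕ} (a b : Bool) (t : Vec Bool m) where

  SquarePath : ℕ → Set
  SquarePath l = ∃₂ λ x y → Σ (Walk Flip (a ∷ b ∷ t) (x ∷ y ∷ t) l) IsPath

  private
    cross : ∀ {y} {s : Vec Bool m} → Flip (a ∷ y ∷ s) (not a ∷ y ∷ s)
    cross = flip-head (x≢not-x a)

    joinHalves : ∀ {l₁ l₂ y c d}
      (w₁ : Walk Flip (a ∷ b ∷ t) (a ∷ y ∷ c) l₁) (w₂ : Walk Flip (not a ∷ y ∷ c) d l₂) →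
      IsPath w₁ → IsPath w₂ →
      All (λ v → head v ≡ a) (vertices w₁) → All (λ v → head v ≡ not a) (vertices w₂) →
      IsPath (w₁ ++⟨ cross ⟩ w₂)
    joinHalves w₁ w₂ p₁ p₂ h₁ h₂ =
      ++-isPath p₁ p₂ (disjoint-by-label head (x≢not-x a) h₁ h₂)

    oddShort : ∀ {z L k} (G : Walk Flip t z L) → IsPath G → k ≤ L → SquarePath (1 + (k + k))
    oddShort {k = k} G G-path k≤L =
      subst SquarePath (+-suc k k) (-, -, shuttle a b P , shuttle-isPath a b (take-isPath k k≤L G-path))
      where P = proj₂ (take k k≤L G)

    evenShort : ∀ {z L k} (G : Walk Flip t z L) → IsPath G → k ≤ L → SquarePath (2 + (k + k))
    evenShort {k = k} G G-path k≤L = subst SquarePath eq (-, -, w , w-path)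
      where
      P = proj₂ (take k k≤L G)
      w = shuttle a b P ++⟨ cross ⟩ [ not a ∷ not b ∷ t ]
      w-path : IsPath w
      w-path = joinHalves (shuttle a b P) [ _ ]
        (shuttle-isPath a b (take-isPath k k≤L G-path)) ([] ∷ [])
        (zigzag-heads a b P _) (refl ∷ [])
      eq : k + suc k + 1 ≡ 2 + (k + k)
      eq = solve 1 (λ k → k :+ (con 1 :+ k) :+ con 1 := con 2 :+ (k :+ k)) refl k

    oddLong : ∀ {z L j} (G : Walk Flip t z L) → IsPath G → j ≤ L → SquarePath (3 + (L + L) + (j + j))
    oddLong {L = L} {j} G G-path j≤L = subst SquarePath eq (-, -, w , w-path)
      where
      P = proj₂ (take j j≤L G)
      w = shuttle a b G ++⟨ cross ⟩ shuttle (not a) (not b) P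
      w-path : IsPath w
      w-path = joinHalves (shuttle a b G) (shuttle (not a) (not b) P)
        (shuttle-isPath a b G-path) (shuttle-isPath (not a) (not b) (take-isPath j j≤L G-path))
        (zigzag-heads a b G _) (zigzag-heads (not a) (not b) P _)
      eq : L + suc L + suc (j + suc j) ≡ 3 + (L + L) + (j + j)
      eq = solve 2 (λ L j → L :+ (con 1 :+ L) :+ (con 1 :+ (j :+ (con 1 :+ j)))
                         := con 3 :+ (L :+ L) :+ (j :+ j)) refl L j

    -- C t must now be reached last, from B t, so row C is entered at the second vertex t₁ of G:
    -- A along G, D back along G to t₁, C along a prefix Q of the rest of G, B back along t Q, then C t.
    evenLong : ∀ {z L j} (G : Walk Flip t z L) → IsPath G → j < L → SquarePath (4 + (L + L) + (j + j))
    evenLong {L = suc L′} {j} G@(_ ∷⟨ e ⟩ T) G-path@(_ ∷ T-path) (s≤s j≤L′) =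
      subst SquarePath eq (-, -, w , w-path)
      where
      Q = proj₂ (take j j≤L′ T)
      -- the prefix of G of length suc j is t ∷⟨ e ⟩ Q
      tQ-path : IsPath (t ∷⟨ e ⟩ Q)
      tQ-path = take-isPath (suc j) (s≤s j≤L′) {G} G-path
      w₂ = zigzag (not a) (not b) Q (reverse Flip-sym (t ∷⟨ e ⟩ Q))
             ++⟨ flip-tail (flip-head (x≢not-x (not b) ∘ sym)) ⟩ [ not a ∷ not b ∷ t ]
      w₂-path : IsPath w₂
      w₂-path = ++-isPath
        (zigzag-isPath (not a) (not b) (take-isPath j j≤L′ T-path) (reverse-isPath Flip-sym tQ-path))
        ([] ∷ [])
        λ { (p , here refl) → zigzag-∌ (not a) (not b) Q _ (Unique.Unique[x∷xs]⇒x∉xs tQ-path) p }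
      w = zigzag a b G (reverse Flip-sym T) ++⟨ cross ⟩ w₂
      w-path : IsPath w
      w-path = joinHalves (zigzag a b G (reverse Flip-sym T)) w₂
        (zigzag-isPath a b {P = G} G-path (reverse-isPath Flip-sym T-path)) w₂-path
        (zigzag-heads a b G _)
        (++-All (zigzag (not a) (not b) Q _) _ [ _ ] (zigzag-heads (not a) (not b) Q _) (refl ∷ []))
      eq : suc L′ + suc L′ + suc (j + suc (suc j) + 1) ≡ 4 + (suc L′ + suc L′) + (j + j)
      eq = solve 2 (λ L j → (con 1 :+ L) :+ (con 1 :+ L) :+ (con 1 :+ (j :+ (con 2 :+ j) :+ con 1))
                          := con 4 :+ ((con 1 :+ L) :+ (con 1 :+ L)) :+ (j :+ j)) refl L′ j

  squarePath : ∀ l → 1 ≤ l → l < 2 ^ (2 + m) → SquarePath l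
  squarePath l 1≤l l<2^[2+m] with grayPath m t
  ... | hamiltonianPath G G-path visits-all
      with squareLength _ l 1≤l (subst (λ N → l < 2 * (2 * N)) (sym visits-all) l<2^[2+m])
  ... | odd-short k≤L = oddShort G G-path k≤L
  ... | even-short k≤L = evenShort G G-path k≤L
  ... | odd-long j≤L = oddLong G G-path j≤L
  ... | even-long j<L = evenLong G G-path j<L

-- The game

DirectorConfines : (V → V → Set) → (V → Set) → Set
DirectorConfines {V} Adj R = ∀ {u : V} {l} → R u → 1 ≤ l →
  (∃ λ w → HasPath Adj u w l) → ∃ λ w → R w × HasPath Adj u w l

confined⇒forces≤ : (R : V → Set) (W : List V) → (∀ {v} → R v → v ∈ W) → DirectorConfines Adj R →
  ∀ {k S u} → All R S → R u → ExplorerForces Adj k S u → k ≤ length W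
confined⇒forces≤ R W R⊆W respond R-S _ (done (xs , xs-unique , refl , xs⊆S)) =
  Unique⇒length≤ xs-unique (All.map (R⊆W ∘ All.lookup R-S) xs⊆S)
confined⇒forces≤ R W R⊆W respond R-S R-u (move l 1≤l path next) with respond R-u 1≤l path
... | w , R-w , u⇝w = confined⇒forces≤ R W R⊆W respond (R-w ∷ R-S) R-w (next w u⇝w)

atLeast-length : Unique xs → AtLeast (length xs) xs
atLeast-length {xs = xs} xs-unique = xs , xs-unique , refl , All.tabulate (λ x∈xs → x∈xs)

forces≤2^n : ∀ {k S} {u : Vec Bool n} → ExplorerForces (QAdj n) k S u → k ≤ 2 ^ n
forces≤2^n {n = n} {S = S} F = subst (_ ≤_) (length-allVertices n)
  (confined⇒forces≤ (λ _ → ⊤) (allVertices n) (λ {v} _ → ∈-allVertices v)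
    (λ _ _ (w , path) → w , tt , path) (All.universal (λ _ → tt) S) tt F)

InSquare : {m : ℕ} → Vec Bool m → Vec Bool (2 + m) → Set
InSquare t v = ∃₂ λ x y → v ≡ x ∷ y ∷ t

square : {m : ℕ} → Vec Bool m → List (Vec Bool (2 + m))
square t =
  (true ∷ true ∷ t) ∷ (true ∷ false ∷ t) ∷ (false ∷ true ∷ t) ∷ (false ∷ false ∷ t) ∷ []

∈-square : ∀ {m} {t : Vec Bool m} {v} → InSquare t v → v ∈ square t
∈-square (true , true , refl) = here refl
∈-square (true , false , refl) = there (here refl)
∈-square (false , true , refl) = there (there (here refl))
∈-square (false , false , refl) = there (there (there (here refl)))

forces≤4 : ∀ {m k S u} (t : Vec Bool m) → All (InSquare t) S → InSquare t u →
  ExplorerForces (QAdj (2 + m)) k S u → k ≤ 4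
forces≤4 t = confined⇒forces≤ (InSquare t) (square t) ∈-square respond
  where
  respond : DirectorConfines (QAdj _) (InSquare t)
  respond {l = l} (x , y , refl) 1≤l (_ , path) with squarePath x y t l 1≤l (path-length<2^n path)
  ... | x′ , y′ , w , w-path = _ , (x′ , y′ , refl) , toHasPath Flip⇒QAdj w w-path

explorer-forces4 : ∀ {m} (v : Vec Bool (2 + m)) → ExplorerForces (QAdj (2 + m)) 4 (v ∷ []) v
explorer-forces4 {m} v =
  move 2 (s≤s z≤n) (somePath v 2 (s≤s z≤n) (s≤s (s≤s (s≤s z≤n)))) λ w₁ v⇝w₁ →
  move 1 (s≤s z≤n) (somePath w₁ 1 (s≤s z≤n) (s≤s (s≤s z≤n))) λ w₂ w₁⇝w₂ →
  move 2 (s≤s z≤n) (somePath w₂ 2 (s≤s z≤n) (s≤s (s≤s (s≤s z≤n)))) λ w₃ w₂⇝w₃ →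
  let p₁ = parity-two-steps v⇝w₁
      p₂ = trans (parity-step w₁⇝w₂) (cong not p₁)
      p₃ = trans (parity-two-steps w₂⇝w₃) p₂
  -- w₁ has the parity of v, while w₂ and w₃ have the other one.
  in done (atLeast-length
       ((path-moves w₂⇝w₃ ∷ parity-distinguishes (trans p₃ (cong not (sym p₁)))
                          ∷ parity-distinguishes p₃ ∷ [])
       ∷ (parity-distinguishes (trans p₂ (cong not (sym p₁))) ∷ parity-distinguishes p₂ ∷ [])
       ∷ (path-moves v⇝w₁ ∷ [])
       ∷ [] ∷ []))
  where
  4≤2^[2+m] : 4 ≤ 2 ^ (2 + m)
  4≤2^[2+m] = *-monoʳ-≤ 2 (*-monoʳ-≤ 2 (m^n>0 2 m))
  somePath : ∀ (u : Vec Bool (2 + m)) l → 1 ≤ l → l < 4 → ∃ λ w → HasPath (QAdj (2 + m)) u w l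
  somePath (x ∷ y ∷ t) l 1≤l l<4 with squarePath x y t l 1≤l (≤-trans l<4 4≤2^[2+m])
  ... | _ , _ , w , w-path = _ , toHasPath Flip⇒QAdj w w-path

fpValue-Q₀ : (v : Vec Bool 0) → FpValue (QAdj 0) v 1
fpValue-Q₀ v = done (atLeast-length ([] ∷ [])) , 1+n≰n ∘ forces≤2^n

fpValue-Q₁ : (v : Vec Bool 1) → FpValue (QAdj 1) v 2
fpValue-Q₁ (x ∷ []) =
  move 1 (s≤s z≤n) (-, toHasPath Flip⇒QAdj step step-path) forced , 1+n≰n ∘ forces≤2^n
  where
  step : Walk Flip (x ∷ []) (not x ∷ []) 1
  step = (x ∷ []) ∷⟨ flip-head (x≢not-x x) ⟩ [ not x ∷ [] ]
  step-path : IsPath step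
  step-path = ((x≢not-x x ∘ ∷-injectiveˡ) ∷ []) ∷ [] ∷ []
  forced : ∀ w → HasPath (QAdj 1) (x ∷ []) w 1 → ExplorerForces (QAdj 1) 2 (w ∷ (x ∷ []) ∷ []) w
  forced w x⇝w = done (atLeast-length ((path-moves x⇝w ∷ []) ∷ [] ∷ []))

fpValue-Q₂₊ : ∀ {m} (v : Vec Bool (2 + m)) → FpValue (QAdj (2 + m)) v 4
fpValue-Q₂₊ v@(x ∷ y ∷ t) =
  explorer-forces4 v , 1+n≰n ∘ forces≤4 t ((x , y , refl) ∷ []) (x , y , refl)

corollary3p4 : (n : ℕ) (v : Vec Bool n) →
    (n ≡ 0 → FpValue (QAdj n) v 1) ×
    (n ≡ 1 → FpValue (QAdj n) v 2) ×
    (2 ≤ n → FpValue (QAdj n) v 4)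
corollary3p4 zero v = (λ _ → fpValue-Q₀ v) , (λ ()) , (λ ())
corollary3p4 (suc zero) v = (λ ()) , (λ _ → fpValue-Q₁ v) , (λ { (s≤s ()) })
corollary3p4 (suc (suc m)) v = (λ ()) , (λ ()) , (λ _ → fpValue-Q₂₊ v)
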